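{- Let $f$ be the function on integers $k\ge 4$ defined by $f(k)=m+1$ if $k\in[k^*_m-1,\,k^*_{m+1}-2]$, where $k^*_1=5$ and $k^*_m = k^*_{m-1}+\frac{3}{16}\cdot 2^{k^*_{m-1}}$ for $m\ge2$. Then $f(k)=O(\log^* k)$.
   Context: $\log^*$ denotes the iterated logarithm. (In the paper, $f(k)=2k-z_k$ where $z_k$ is the number of LZ-End phrases of the $k$-th period-doubling sequence.) -}

module Defs where

open import Data.Nat using (ℕ; zero; suc; _+_; _*_; _∸_; _^_; _≤_; _≤ᵇ_)
open import Data.Nat.DivMod using (_/_)
open import Data.Nat.Logarithm using (⌊log₂_⌋)
open import Data.Bool using (if_then_else_)
open import Data.Product using (Σ; _×_)
open import Relation.Binary.PropositionalEquality using (_≡_)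

-- kstar m = k*_m for m ≥ 1:  k*_1 = 5,  k*_m = k*_{m-1} + (3/16)·2^{k*_{m-1}}.
-- (3 · 2^k is divisible by 16 for k ≥ 4, so ℕ-division is exact here.)
-- The value at index 0 is a dummy (never used: the statement requires m ≥ 1).
kstar : ℕ → ℕ
kstar zero = 5
kstar (suc zero) = 5
kstar (suc (suc m)) = kstar (suc m) + (3 * 2 ^ kstar (suc m)) / 16

-- f k ≡ v  (for k ≥ 4):  v = m + 1 where m ≥ 1 and k ∈ [k*_m − 1, k*_{m+1} − 2].
-- The intervals partition {k ≥ 4}, so this relation is the graph of f.
IsF : ℕ → ℕ → Set
IsF k v = Σ ℕ (λ m → (1 ≤ m) × (kstar m ∸ 1 ≤ k) × (k ≤ kstar (suc m) ∸ 2) × (v ≡ suc m))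

-- Iterated logarithm (base 2): number of applications of ⌊log₂⌋ needed
-- to bring n down to ≤ 1.  Fuel n suffices since ⌊log₂ n⌋ < n for n ≥ 1.
logStarAux : ℕ → ℕ → ℕ
logStarAux zero n = 0
logStarAux (suc fuel) n = if n ≤ᵇ 1 then 0 else suc (logStarAux fuel ⌊log₂ n ⌋)

log* : ℕ → ℕ
log* n = logStarAux n n

-- Put a_m = k*_m − 3.  Since 3·2^K/16 ≥ 2^(K−3), the recurrence gives a_{m+1} ≥ 2^{a_m},
-- and every such exponentiation raises log* by at least one; with a_1 = 2 this yields
-- m ≤ log* a_m.  On the m-th interval k ≥ k*_m − 1 ≥ a_m, so f(k) = m + 1 ≤ 2m ≤ 2 log* k.
module Submission where

open import Defs
open import Data.Nat using (ℕ; zero; suc; _+_; _*_; _∸_; _^_; _≤_; z≤n; s≤s)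
open import Data.Nat.Properties
open import Data.Nat.Logarithm using (⌊log₂_⌋; ⌊log₂⌋-mono-≤; ⌊log₂[2^n]⌋≡n)
open import Data.Nat.DivMod using (_/_; /-monoˡ-≤; m*n/n≡m)
open import Data.Product using (∃; ∃-syntax; _,_)
open import Relation.Binary.PropositionalEquality using (_≡_; refl; sym; cong; subst; module ≡-Reasoning)
open ≡-Reasoning

1+n≤2^n : ∀ n → suc n ≤ 2 ^ n
1+n≤2^n zero = ≤-refl
1+n≤2^n (suc n) = subst (suc (suc n) ≤_) (cong (2 ^ n +_) (sym (+-identityʳ (2 ^ n))))
  (+-mono-≤ (m^n>0 2 n) (1+n≤2^n n))

⌊log₂[1+n]⌋≤n : ∀ n → ⌊log₂ suc n ⌋ ≤ n
⌊log₂[1+n]⌋≤n n = subst (⌊log₂ suc n ⌋ ≤_) (⌊log₂[2^n]⌋≡n n) (⌊log₂⌋-mono-≤ (1+n≤2^n n))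

-- Fuel at least the argument never runs out, because ⌊log₂⌋ decreases positive numbers.
logStarAux-mono : ∀ {f g n m} → n ≤ m → n ≤ f → m ≤ g → logStarAux f n ≤ logStarAux g m
logStarAux-mono {zero} _ _ _ = z≤n
logStarAux-mono {suc f} {n = zero} _ _ _ = z≤n
logStarAux-mono {suc f} {n = suc zero} _ _ _ = z≤n
logStarAux-mono {suc f} {n = suc (suc n)} {suc zero} (s≤s ()) _ _
logStarAux-mono {suc f} {suc g} {suc (suc n)} {suc (suc m)} n≤m (s≤s n≤f) (s≤s m≤g) =
  s≤s (logStarAux-mono (⌊log₂⌋-mono-≤ n≤m)
        (≤-trans (⌊log₂[1+n]⌋≤n (suc n)) n≤f)
        (≤-trans (⌊log₂[1+n]⌋≤n (suc m)) m≤g))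

log*-mono-≤ : ∀ {n m} → n ≤ m → log* n ≤ log* m
log*-mono-≤ n≤m = logStarAux-mono n≤m ≤-refl ≤-refl

1+log*≤log*[2^] : ∀ j {n} → 2 ≤ n → 2 ^ j ≤ n → suc (log* j) ≤ log* n
1+log*≤log*[2^] j {suc zero} (s≤s ()) _
1+log*≤log*[2^] j {suc (suc n)} _ 2^j≤n =
  s≤s (logStarAux-mono j≤log₂n ≤-refl (⌊log₂[1+n]⌋≤n (suc n)))
  where
  j≤log₂n : j ≤ ⌊log₂ suc (suc n) ⌋
  j≤log₂n = subst (_≤ ⌊log₂ suc (suc n) ⌋) (⌊log₂[2^n]⌋≡n j) (⌊log₂⌋-mono-≤ 2^j≤n)

kstar≥5 : ∀ m → 5 ≤ kstar m
kstar≥5 zero = ≤-refl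
kstar≥5 (suc zero) = ≤-refl
kstar≥5 (suc (suc m)) = ≤-trans (kstar≥5 (suc m)) (m≤m+n _ _)

2^[K∸3]≤3*2^K/16 : ∀ K → 3 ≤ K → 2 ^ (K ∸ 3) ≤ (3 * 2 ^ K) / 16
2^[K∸3]≤3*2^K/16 K 3≤K = subst (_≤ (3 * 2 ^ K) / 16) (m*n/n≡m (2 ^ (K ∸ 3)) 16)
  (/-monoˡ-≤ 16 (subst (2 ^ (K ∸ 3) * 16 ≤_) (sym 3*2^K≡)
    (*-monoʳ-≤ (2 ^ (K ∸ 3)) (m≤m+n 16 8))))
  where
  3*2^K≡ : 3 * 2 ^ K ≡ 2 ^ (K ∸ 3) * 24
  3*2^K≡ = begin
    3 * 2 ^ K                   ≡⟨ cong (λ e → 3 * 2 ^ e) (sym (m∸n+n≡m 3≤K)) ⟩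
    3 * 2 ^ (K ∸ 3 + 3)         ≡⟨ cong (3 *_) (^-distribˡ-+-* 2 (K ∸ 3) 3) ⟩
    3 * (2 ^ (K ∸ 3) * 8)       ≡⟨ *-comm 3 (2 ^ (K ∸ 3) * 8) ⟩
    2 ^ (K ∸ 3) * 8 * 3         ≡⟨ *-assoc (2 ^ (K ∸ 3)) 8 3 ⟩
    2 ^ (K ∸ 3) * 24            ∎

kstar-growth : ∀ m → 2 ^ (kstar (suc m) ∸ 3) ≤ kstar (suc (suc m)) ∸ 3
kstar-growth m = ≤-trans (2^[K∸3]≤3*2^K/16 K 3≤K)
  (subst (((3 * 2 ^ K) / 16) ≤_) (sym (+-∸-comm ((3 * 2 ^ K) / 16) 3≤K)) (m≤n+m _ _))
  where
  K = kstar (suc m)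
  3≤K : 3 ≤ K
  3≤K = ≤-trans (m≤m+n 3 2) (kstar≥5 (suc m))

m≤log*[kstar-3] : ∀ m → m ≤ log* (kstar m ∸ 3)
m≤log*[kstar-3] zero = z≤n
m≤log*[kstar-3] (suc zero) = ≤-refl
m≤log*[kstar-3] (suc (suc m)) = ≤-trans (s≤s (m≤log*[kstar-3] (suc m)))
  (1+log*≤log*[2^] (kstar (suc m) ∸ 3) (∸-monoˡ-≤ 3 (kstar≥5 (suc (suc m)))) (kstar-growth m))

lemma9 : ∃[ C ] ∃[ N ] (∀ k v → N ≤ k → 4 ≤ k → IsF k v → v ≤ C * log* k)
lemma9 = 2 , 0 , λ { k v _ _ (m , 1≤m , kstar-1≤k , _ , refl) →
  let m≤log*k = ≤-trans (m≤log*[kstar-3] m)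
                  (log*-mono-≤ (≤-trans (∸-monoʳ-≤ (kstar m) (m≤m+n 1 2)) kstar-1≤k))
  in ≤-trans (1+m≤2*m 1≤m) (*-monoʳ-≤ 2 m≤log*k) }
  where
  1+m≤2*m : ∀ {m} → 1 ≤ m → suc m ≤ 2 * m
  1+m≤2*m {m} 1≤m = subst (suc m ≤_) (cong (m +_) (sym (+-identityʳ m))) (+-monoˡ-≤ m 1≤m)
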